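{- Let $A$ be an srl-monoid and $\theta$ a congruence of $A$. Then for all $a,b\in A$, $(a,b)\in \theta$ if and only if $s(a,b)\in e/\theta$, where $s(a,b)=(a\rightarrow b)\wedge (b\rightarrow a)\wedge e$ and $e/\theta$ is the $\theta$-class of $e$.
   Context: A commutative l-monoid is an algebra $(A,\wedge,\vee,\cdot,e)$ of type $(2,2,2,0)$ such that $(A,\wedge,\vee)$ is a lattice, $(A,\cdot,e)$ is a commutative monoid and $(a\vee b)\cdot c=(a\cdot c)\vee(b\cdot c)$ for all $a,b,c\in A$. An algebra $(A,\wedge,\vee,\cdot,\rightarrow,e)$ of type $(2,2,2,2,0)$ is an srl-monoid if $(A,\wedge,\vee,\cdot,e)$ is a commutative l-monoid and there is a subalgebra $Q$ of $(A,\wedge,\vee,\cdot,e)$ such that for all $a,b\in A$ the set $\{q\in Q: a\cdot q\leq b\}$ has a maximum and $a\rightarrow b$ equals this maximum. Congruences are congruences of the algebra $(A,\wedge,\vee,\cdot,\rightarrow,e)$. -}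

module Defs where

open import Level using (Level; suc; _⊔_)
open import Relation.Binary.PropositionalEquality using (_≡_)
open import Algebra.Core using (Op₂)
open import Algebra.Lattice.Structures using (IsLattice)
open import Algebra.Structures using (IsCommutativeMonoid)
open import Relation.Binary.Structures using (IsEquivalence)

record CommLMonoid (c : Level) : Set (suc c) where
  infixr 6 _∨_
  infixr 7 _∧_
  infixl 8 _·_
  field
    Carrier   : Set c
    _∧_       : Op₂ Carrier
    _∨_       : Op₂ Carrier
    _·_       : Op₂ Carrier
    e         : Carrier
    isLattice : IsLattice _≡_ _∨_ _∧_
    isCommutativeMonoid : IsCommutativeMonoid _≡_ _·_ e
    ·-distrib-∨ : ∀ a b c → (a ∨ b) · c ≡ (a · c) ∨ (b · c)

  _≤_ : Carrier → Carrier → Set c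
  a ≤ b = a ∧ b ≡ a

record IsSubalgebra {c : Level} (L : CommLMonoid c) (Q : CommLMonoid.Carrier L → Set c) : Set c where
  open CommLMonoid L
  field
    ∧-closed : ∀ {x y} → Q x → Q y → Q (x ∧ y)
    ∨-closed : ∀ {x y} → Q x → Q y → Q (x ∨ y)
    ·-closed : ∀ {x y} → Q x → Q y → Q (x · y)
    e-closed : Q e

record SrlMonoid (c : Level) : Set (suc c) where
  field
    lMonoid : CommLMonoid c
  open CommLMonoid lMonoid public
  infixr 5 _⇒_
  field
    _⇒_ : Op₂ Carrier
    Q : Carrier → Set c
    Q-subalgebra : IsSubalgebra lMonoid Q
    ⇒-in-Q   : ∀ a b → Q (a ⇒ b)
    ⇒-bound  : ∀ a b → (a · (a ⇒ b)) ≤ b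
    ⇒-max    : ∀ a b q → Q q → (a · q) ≤ b → q ≤ (a ⇒ b)

  s : Carrier → Carrier → Carrier
  s a b = (a ⇒ b) ∧ (b ⇒ a) ∧ e

record IsCongruence {c ℓ : Level} (A : SrlMonoid c) (θ : SrlMonoid.Carrier A → SrlMonoid.Carrier A → Set ℓ) : Set (c ⊔ ℓ) where
  open SrlMonoid A
  field
    isEquivalence : IsEquivalence θ
    ∧-cong : ∀ {a b c d} → θ a b → θ c d → θ (a ∧ c) (b ∧ d)
    ∨-cong : ∀ {a b c d} → θ a b → θ c d → θ (a ∨ c) (b ∨ d)
    ·-cong : ∀ {a b c d} → θ a b → θ c d → θ (a · c) (b · d)
    ⇒-cong : ∀ {a b c d} → θ a b → θ c d → θ (a ⇒ c) (b ⇒ d)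

{-# OPTIONS --safe #-}
module Submission where

open import Defs
open import Level using (Level)
open import Data.Product using (_×_; _,_)
open import Relation.Binary.PropositionalEquality using (_≡_; sym; trans; cong; cong₂; module ≡-Reasoning)
open import Relation.Binary.Bundles using (Setoid)
open import Algebra.Structures using (IsCommutativeMonoid)
open import Algebra.Lattice.Bundles using (Lattice)
open import Algebra.Lattice.Structures using (IsLattice)
import Algebra.Lattice.Properties.Lattice as LatticeProperties
import Relation.Binary.Lattice as OrderTheoretic
import Relation.Binary.Lattice.Properties.JoinSemilattice as JoinSemilatticeProperties
import Relation.Binary.Reasoning.Setoid as SetoidReasoning

-- (a,b) ∈ θ forces s(a,b) θ s(b,b) = e since e ≤ b → b.
-- Conversely, a · s(a,b) ≤ a · (a → b) ≤ b, so if s(a,b) θ e then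
-- a ∨ b θ (a · s(a,b)) ∨ b = b, and symmetrically a ∨ b θ a.

module CommLMonoidProperties {c : Level} (L : CommLMonoid c) where
  open CommLMonoid L
  open IsCommutativeMonoid isCommutativeMonoid using (comm)

  lattice : Lattice c c
  lattice = record { isLattice = isLattice }

  open LatticeProperties lattice public using (∧-idem)
  open OrderTheoretic.Lattice (LatticeProperties.∨-∧-orderTheoreticLattice lattice)
    using (joinSemilattice) renaming (x∧y≤x to x≡x∧y∧x)

  -- The library orders a lattice by x ≡ x ∧ y, the mirror image of _≤_.
  x∧y≤x : ∀ x y → (x ∧ y) ≤ x
  x∧y≤x x y = sym (x≡x∧y∧x x y)

  x≤y⇒x∨y≡y : ∀ {x y} → x ≤ y → x ∨ y ≡ y
  x≤y⇒x∨y≡y x≤y = JoinSemilatticeProperties.x≤y⇒x∨y≈y joinSemilattice (sym x≤y)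

  ·-distribˡ-∨ : ∀ a x y → a · (x ∨ y) ≡ a · x ∨ a · y
  ·-distribˡ-∨ a x y = begin
    a · (x ∨ y)          ≡⟨ comm a (x ∨ y) ⟩
    (x ∨ y) · a          ≡⟨ ·-distrib-∨ x y a ⟩
    x · a ∨ y · a        ≡⟨ cong₂ _∨_ (comm x a) (comm y a) ⟩
    a · x ∨ a · y        ∎
    where open ≡-Reasoning

module SrlMonoidProperties {c : Level} (A : SrlMonoid c) where
  open SrlMonoid A
  open CommLMonoidProperties lMonoid
  open IsLattice isLattice using (∧-comm; ∧-assoc; ∨-assoc)
  open IsCommutativeMonoid isCommutativeMonoid using (identityʳ)

  e≤x⇒x : ∀ x → e ≤ (x ⇒ x)
  e≤x⇒x x = ⇒-max x x e (IsSubalgebra.e-closed Q-subalgebra) x·e≤x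
    where
    x·e≤x : (x · e) ≤ x
    x·e≤x rewrite identityʳ x = ∧-idem x

  s-diagonal : ∀ x → s x x ≡ e
  s-diagonal x = begin
    (x ⇒ x) ∧ (x ⇒ x) ∧ e  ≡⟨ cong ((x ⇒ x) ∧_) [x⇒x]∧e≡e ⟩
    (x ⇒ x) ∧ e            ≡⟨ [x⇒x]∧e≡e ⟩
    e                      ∎
    where
    open ≡-Reasoning
    [x⇒x]∧e≡e : (x ⇒ x) ∧ e ≡ e
    [x⇒x]∧e≡e = trans (∧-comm (x ⇒ x) e) (e≤x⇒x x)

  s-comm : ∀ a b → s a b ≡ s b a
  s-comm a b = begin
    (a ⇒ b) ∧ (b ⇒ a) ∧ e    ≡⟨ ∧-assoc (a ⇒ b) (b ⇒ a) e ⟨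
    ((a ⇒ b) ∧ (b ⇒ a)) ∧ e  ≡⟨ cong (_∧ e) (∧-comm (a ⇒ b) (b ⇒ a)) ⟩
    ((b ⇒ a) ∧ (a ⇒ b)) ∧ e  ≡⟨ ∧-assoc (b ⇒ a) (a ⇒ b) e ⟩
    (b ⇒ a) ∧ (a ⇒ b) ∧ e    ∎
    where open ≡-Reasoning

  x·s[x,y]∨y≡y : ∀ a b → a · s a b ∨ b ≡ b
  x·s[x,y]∨y≡y a b = begin
    a · s a b ∨ b                   ≡⟨ cong (a · s a b ∨_) a·[a⇒b]∨b≡b ⟨
    a · s a b ∨ (a · (a ⇒ b) ∨ b)   ≡⟨ ∨-assoc (a · s a b) (a · (a ⇒ b)) b ⟨
    (a · s a b ∨ a · (a ⇒ b)) ∨ b   ≡⟨ cong (_∨ b) (·-distribˡ-∨ a (s a b) (a ⇒ b)) ⟨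
    a · (s a b ∨ (a ⇒ b)) ∨ b       ≡⟨ cong (λ z → a · z ∨ b) (x≤y⇒x∨y≡y (x∧y≤x (a ⇒ b) _)) ⟩
    a · (a ⇒ b) ∨ b                 ≡⟨ a·[a⇒b]∨b≡b ⟩
    b                               ∎
    where
    open ≡-Reasoning
    a·[a⇒b]∨b≡b : a · (a ⇒ b) ∨ b ≡ b
    a·[a⇒b]∨b≡b = x≤y⇒x∨y≡y (⇒-bound a b)

module CongruenceProperties {c ℓ : Level} (A : SrlMonoid c)
    (θ : SrlMonoid.Carrier A → SrlMonoid.Carrier A → Set ℓ) (isCongruence : IsCongruence A θ) where
  open SrlMonoid A
  open SrlMonoidProperties A
  open IsCongruence isCongruence
  open IsLattice isLattice using (∨-comm)
  open IsCommutativeMonoid isCommutativeMonoid using (identityʳ)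

  setoid : Setoid c ℓ
  setoid = record { isEquivalence = isEquivalence }

  open Setoid setoid using (reflexive)
    renaming (refl to θ-refl; sym to θ-sym; trans to θ-trans)
  open SetoidReasoning setoid

  s-cong : ∀ {a b c d} → θ a c → θ b d → θ (s a b) (s c d)
  s-cong θac θbd = ∧-cong (⇒-cong θac θbd) (∧-cong (⇒-cong θbd θac) θ-refl)

  θ⇒sθe : ∀ {a b} → θ a b → θ (s a b) e
  θ⇒sθe {a} {b} θab = θ-trans (s-cong θab θ-refl) (reflexive (s-diagonal b))

  sθe⇒[a∨b]θb : ∀ {a b} → θ (s a b) e → θ (a ∨ b) b
  sθe⇒[a∨b]θb {a} {b} sθe = begin
    a ∨ b              ≡⟨ cong (_∨ b) (identityʳ a) ⟨
    a · e ∨ b          ≈⟨ ∨-cong (·-cong θ-refl (θ-sym sθe)) θ-refl ⟩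
    a · s a b ∨ b      ≡⟨ x·s[x,y]∨y≡y a b ⟩
    b                  ∎

  sθe⇒θ : ∀ {a b} → θ (s a b) e → θ a b
  sθe⇒θ {a} {b} sθe = begin
    a      ≈⟨ sθe⇒[a∨b]θb (θ-trans (reflexive (s-comm b a)) sθe) ⟨
    b ∨ a  ≡⟨ ∨-comm b a ⟩
    a ∨ b  ≈⟨ sθe⇒[a∨b]θb sθe ⟩
    b      ∎

lemma3p3 : {c ℓ : Level} (A : SrlMonoid c) (θ : SrlMonoid.Carrier A → SrlMonoid.Carrier A → Set ℓ) →
    IsCongruence A θ → (a b : SrlMonoid.Carrier A) →
    (θ a b → θ (SrlMonoid.s A a b) (SrlMonoid.e A)) × (θ (SrlMonoid.s A a b) (SrlMonoid.e A) → θ a b)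
lemma3p3 A θ isCongruence a b = θ⇒sθe , sθe⇒θ
  where open CongruenceProperties A θ isCongruence
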